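{- For $1\le m\le n$, the number of vacillating $(m,n)$-parking functions is \[ |\mathrm{VPF}_{m,n}|=\sum_{\pi=\pi_1\cdots\pi_n\in\mathfrak{S}_{m,n}}\left(\prod_{i=1}^n\bigl[\widehat{\mathrm{B}}(\pi_i)+\widehat{\mathrm{F}}(\pi_i)+1\bigr]\right), \] where $\widehat{\mathrm{B}}(0)=\widehat{\mathrm{F}}(0)=0$ and, for $\pi_i>0$, $\widehat{\mathrm{B}}(\pi_i)=\min(\mathrm{Right}(\pi_i),1)$ and $\widehat{\mathrm{F}}(\pi_i)$ equals $0$ if $\mathrm{Left}(\pi_i)=0$, $\min(i-1,1)$ if $0<\mathrm{Left}(\pi_i)=i-1$, and $\max(\min(\mathrm{Left}(\pi_i)-1,1),0)$ if $0<\mathrm{Left}(\pi_i)<i-1$.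
   Context: Vacillating parking rule: cars $1,\dots,m$ with preferences $\alpha=(a_1,\dots,a_m)\in[n]^m$ enter in order a one-way street with spots $1,\dots,n$; car $j$ checks spot $a_j$, then spot $a_j-1$ (if it exists), then spot $a_j+1$ (if it exists), in this order, and parks in the first empty one among these; otherwise it fails. $\mathrm{VPF}_{m,n}$ is the set of $\alpha$ under which all cars park (this is the $(1,1)$-pullback rule). $\mathfrak{S}_{m,n}$ is the set of words $\pi_1\cdots\pi_n$ that are permutations of the multiset of $n-m$ zeros and the elements of $[m]$. $\mathrm{Right}(\pi_i)$ is the largest $x\ge0$ with $0<\pi_t<\pi_i$ for all $i+1\le t\le i+x\le n$; $\mathrm{Left}(\pi_i)$ is the largest $x\ge0$ with $0<\pi_t<\pi_i$ for all $1\le i-x\le t\le i-1$. -}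

module Defs where

open import Data.Nat using (ℕ; zero; suc; _+_; _*_; _∸_; _≡ᵇ_; _<ᵇ_; _⊓_; _⊔_)
open import Data.Bool using (Bool; true; false; if_then_else_; _∧_; _∨_; not)
open import Data.List using (List; []; _∷_; map; concatMap; length; sum; replicate; _++_; filterᵇ; reverse)
open import Data.Maybe using (Maybe; just; nothing; is-just)

range : ℕ → ℕ → List ℕ
range a zero = []
range a (suc k) = a ∷ range (suc a) k

oneTo : ℕ → List ℕ
oneTo n = range 1 n

words : List ℕ → ℕ → List (List ℕ)
words vs zero = [] ∷ []
words vs (suc k) = concatMap (λ v → map (v ∷_) (words vs k)) vs

elem : ℕ → List ℕ → Bool
elem x [] = false
elem x (y ∷ ys) = (x ≡ᵇ y) ∨ elem x ys

-- Vacillating parking rule on spots 1..n.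
-- The state is the list of occupied spots. A car preferring a checks a,
-- then a-1 (if a-1 ≥ 1), then a+1 (if a+1 ≤ n); nothing = the car fails.

free : ℕ → ℕ → List ℕ → Bool
free n s occ = (0 <ᵇ s) ∧ ((s <ᵇ suc n) ∧ not (elem s occ))

parkCar : ℕ → List ℕ → ℕ → Maybe (List ℕ)
parkCar n occ a =
  if free n a occ then just (a ∷ occ)
  else if free n (a ∸ 1) occ ∧ (1 <ᵇ a) then just ((a ∸ 1) ∷ occ)
  else if free n (suc a) occ then just (suc a ∷ occ)
  else nothing

parkAll : ℕ → List ℕ → List ℕ → Maybe (List ℕ)
parkAll n occ [] = just occ
parkAll n occ (a ∷ as) with parkCar n occ a
... | nothing = nothing
... | just occ' = parkAll n occ' as

isVPF : ℕ → List ℕ → Bool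
isVPF n α = is-just (parkAll n [] α)

VPF : ℕ → ℕ → List (List ℕ)
VPF m n = filterᵇ (isVPF n) (words (oneTo n) m)

count : ℕ → List ℕ → ℕ
count x [] = 0
count x (y ∷ ys) = (if x ≡ᵇ y then 1 else 0) + count x ys

baseMultiset : ℕ → ℕ → List ℕ
baseMultiset m n = replicate (n ∸ m) 0 ++ oneTo m

allB : (ℕ → Bool) → List ℕ → Bool
allB p [] = true
allB p (x ∷ xs) = p x ∧ allB p xs

isPermOfBase : ℕ → ℕ → List ℕ → Bool
isPermOfBase m n π =
  allB (λ v → count v π ≡ᵇ count v (baseMultiset m n)) (range 0 (suc m))

𝔖 : ℕ → ℕ → List (List ℕ)
𝔖 m n = filterᵇ (isPermOfBase m n) (words (range 0 (suc m)) n)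

run : ℕ → List ℕ → ℕ
run p [] = 0
run p (t ∷ ts) = if (0 <ᵇ t) ∧ (t <ᵇ p) then suc (run p ts) else 0

-- For position i (1-based) with value p, pre = π_1 ... π_{i-1}, suf = π_{i+1} ... π_n:
Right : ℕ → List ℕ → ℕ
Right p suf = run p suf

Left : ℕ → List ℕ → ℕ
Left p pre = run p (reverse pre)

-- Bhat, Fhat for π_i = p at position i (i-1 = length pre)
Bhat : List ℕ → ℕ → List ℕ → ℕ
Bhat pre zero suf = 0
Bhat pre (suc q) suf = Right (suc q) suf ⊓ 1

Fhat : List ℕ → ℕ → List ℕ → ℕ
Fhat pre zero suf = 0
Fhat pre (suc q) suf with Left (suc q) pre
... | zero = 0
... | suc l =
  if suc l ≡ᵇ length pre then (length pre ⊓ 1)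
  else ((suc l ∸ 1) ⊓ 1) ⊔ 0

weightGo : List ℕ → List ℕ → ℕ
weightGo pre [] = 1
weightGo pre (p ∷ suf) =
  (Bhat pre p suf + Fhat pre p suf + 1) * weightGo (pre ++ (p ∷ [])) suf

weight : List ℕ → ℕ
weight π = weightGo [] π

-- Both sides are the values at h = 1 of two sums weighted by a test function h on occupancy
-- patterns of the spots 1..n: the sum of h(final occupancy) over the preference words of k cars
-- that all park, and the sum of weight π · h(nonzero positions of π) over π ∈ 𝔖_{k,n}. Both
-- satisfy X_{k+1}(h) = X_k(T h), where (T h)(g) sums h(g plus the spot where one more car lands)
-- over the n preferences of that car. For parking this is adding the last car. For words, each
-- word of 𝔖_{k+1,n} arises exactly once by writing k+1 into a zero position s of a word of
-- 𝔖_{k,n}; as the largest letter, k+1 ends every Left/Right run exactly as the 0 did, so only its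
-- own factor B̂ + F̂ + 1 is new, and that factor counts the preferences whose car lands on the
-- vacant spot s. Induction on k from the empty street and the all-zero word gives the identity.

module Submission where

open import Defs
open import Data.Nat using (ℕ; zero; suc; _+_; _*_; _∸_; _≤_; _<_; _≡ᵇ_; _<ᵇ_; _⊓_; _⊔_; z≤n; s≤s)
open import Data.Nat.ListAction using (sum)
open import Data.Nat.ListAction.Properties using (sum-++)
import Data.Nat.Properties as ℕ
open import Data.Nat.Tactic.RingSolver using (solve-∀)
open import Data.Bool using (Bool; true; false; if_then_else_; _∧_; _∨_; not; T?)
import Data.Bool.Properties as Bool
open import Data.List using (List; []; _∷_; [_]; length; map; concatMap; _++_; filterᵇ; replicate; reverse)
import Data.List.Properties as List
open import Data.List.Relation.Unary.All as All using (All; []; _∷_)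
import Data.List.Relation.Unary.All.Properties as All
open import Data.Maybe using (Maybe; just; nothing; is-just; maybe′; _>>=_)
import Data.Maybe as Maybe
open import Data.Product using (_×_; _,_; proj₂)
open import Function using (_∘_)
open import Function.Definitions using (Congruent)
open import Relation.Binary.PropositionalEquality using (_≡_; _≗_; refl; sym; trans; cong; cong₂; subst; module ≡-Reasoning)
open ≡-Reasoning

private
  variable
    A B : Set

∑ : List A → (A → ℕ) → ℕ
∑ xs f = sum (map f xs)

∑-++ : (xs ys : List A) (f : A → ℕ) → ∑ (xs ++ ys) f ≡ ∑ xs f + ∑ ys f
∑-++ xs ys f = trans (cong sum (List.map-++ f xs ys)) (sum-++ (map f xs) (map f ys))

∑-map : (g : A → B) (xs : List A) (f : B → ℕ) → ∑ (map g xs) f ≡ ∑ xs (f ∘ g)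
∑-map g xs f = cong sum (sym (List.map-∘ xs))

∑-concatMap : (g : A → List B) (xs : List A) (f : B → ℕ) →
  ∑ (concatMap g xs) f ≡ ∑ xs (λ x → ∑ (g x) f)
∑-concatMap g [] f = refl
∑-concatMap g (x ∷ xs) f = trans (∑-++ (g x) (concatMap g xs) f) (cong (∑ (g x) f +_) (∑-concatMap g xs f))

∑-cong : (xs : List A) {f g : A → ℕ} → f ≗ g → ∑ xs f ≡ ∑ xs g
∑-cong xs f≗g = cong sum (List.map-cong f≗g xs)

∑-cong-All : {P : A → Set} {xs : List A} {f g : A → ℕ} →
  All P xs → (∀ x → P x → f x ≡ g x) → ∑ xs f ≡ ∑ xs g
∑-cong-All ps eq = cong sum (List.map-cong-local (All.map (λ {x} → eq x) ps))

∑-zero : (xs : List A) → ∑ xs (λ _ → 0) ≡ 0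
∑-zero [] = refl
∑-zero (x ∷ xs) = ∑-zero xs

∑-+ : (xs : List A) (f g : A → ℕ) → ∑ xs (λ x → f x + g x) ≡ ∑ xs f + ∑ xs g
∑-+ [] f g = refl
∑-+ (x ∷ xs) f g = trans (cong (f x + g x +_) (∑-+ xs f g)) (+-interchange (f x) (g x) _ _)
  where
  +-interchange : ∀ a b c d → a + b + (c + d) ≡ a + c + (b + d)
  +-interchange = solve-∀

∑-+₃ : (xs : List A) (f g h : A → ℕ) → ∑ xs (λ x → f x + g x + h x) ≡ ∑ xs f + ∑ xs g + ∑ xs h
∑-+₃ xs f g h = trans (∑-+ xs (λ x → f x + g x) h) (cong (_+ ∑ xs h) (∑-+ xs f g))

∑-*ˡ : (xs : List A) (c : ℕ) (f : A → ℕ) → ∑ xs (λ x → c * f x) ≡ c * ∑ xs f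
∑-*ˡ [] c f = sym (ℕ.*-zeroʳ c)
∑-*ˡ (x ∷ xs) c f = trans (cong (c * f x +_) (∑-*ˡ xs c f)) (sym (ℕ.*-distribˡ-+ c (f x) (∑ xs f)))

∑-if : (xs : List A) (b : Bool) (f : A → ℕ) → ∑ xs (λ x → if b then f x else 0) ≡ (if b then ∑ xs f else 0)
∑-if xs true f = refl
∑-if xs false f = ∑-zero xs

∑-filterᵇ : (p : A → Bool) (xs : List A) (f : A → ℕ) →
  ∑ (filterᵇ p xs) f ≡ ∑ xs (λ x → if p x then f x else 0)
∑-filterᵇ p [] f = refl
∑-filterᵇ p (x ∷ xs) f with p x
... | true = cong (f x +_) (∑-filterᵇ p xs f)
... | false = ∑-filterᵇ p xs f

length-filterᵇ : (p : A → Bool) (xs : List A) → length (filterᵇ p xs) ≡ ∑ xs (λ x → if p x then 1 else 0)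
length-filterᵇ p [] = refl
length-filterᵇ p (x ∷ xs) with p x
... | true = cong suc (length-filterᵇ p xs)
... | false = length-filterᵇ p xs

<ᵇ-true : ∀ {m n} → m < n → (m <ᵇ n) ≡ true
<ᵇ-true {zero} {suc n} _ = refl
<ᵇ-true {suc m} {suc n} (s≤s m<n) = <ᵇ-true m<n

<ᵇ-false : ∀ {m n} → n ≤ m → (m <ᵇ n) ≡ false
<ᵇ-false {m} {zero} _ = refl
<ᵇ-false {suc m} {suc n} (s≤s n≤m) = <ᵇ-false n≤m

≡ᵇ-refl : ∀ m → (m ≡ᵇ m) ≡ true
≡ᵇ-refl zero = refl
≡ᵇ-refl (suc m) = ≡ᵇ-refl m

<⇒≡ᵇ-false : ∀ {m n} → m < n → (m ≡ᵇ n) ≡ false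
<⇒≡ᵇ-false {zero} {suc n} _ = refl
<⇒≡ᵇ-false {suc m} {suc n} (s≤s m<n) = <⇒≡ᵇ-false m<n

>⇒≡ᵇ-false : ∀ {m n} → n < m → (m ≡ᵇ n) ≡ false
>⇒≡ᵇ-false {suc m} {zero} _ = refl
>⇒≡ᵇ-false {suc m} {suc n} (s≤s n<m) = >⇒≡ᵇ-false n<m

≡ᵇ-cancelʳ-+ : ∀ a b e → (a + e ≡ᵇ b + e) ≡ (a ≡ᵇ b)
≡ᵇ-cancelʳ-+ a b zero rewrite ℕ.+-identityʳ a | ℕ.+-identityʳ b = refl
≡ᵇ-cancelʳ-+ a b (suc e) rewrite ℕ.+-suc a e | ℕ.+-suc b e = ≡ᵇ-cancelʳ-+ a b e

𝟙 : Bool → ℕ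
𝟙 b = if b then 1 else 0

if-then-0 : ∀ b x → (if b then x else 0) ≡ 𝟙 b * x
if-then-0 true x = sym (ℕ.+-identityʳ x)
if-then-0 false x = refl

if-false : ∀ {b} x → b ≡ false → (if b then x else 0) ≡ 0
if-false x refl = refl

indicator-split : ∀ v b c x →
  (if v then x else 0) + (if v ∧ b then x else 0) + (if v ∧ c then x else 0) ≡ (if v then 𝟙 b + 𝟙 c + 1 else 0) * x
indicator-split false b c x = refl
indicator-split true b c x = trans (cong₂ (λ y z → x + y + z) (if-then-0 b x) (if-then-0 c x)) (rearrange (𝟙 b) (𝟙 c) x)
  where
  rearrange : ∀ y z x → x + y * x + z * x ≡ (y + z + 1) * x
  rearrange = solve-∀

range-snoc : ∀ a k → range a (suc k) ≡ range a k ++ [ a + k ]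
range-snoc a zero = cong [_] (sym (ℕ.+-identityʳ a))
range-snoc a (suc k) = cong (a ∷_) (trans (range-snoc (suc a) k) (cong (λ z → range (suc a) k ++ [ z ]) (sym (ℕ.+-suc a k))))

range-suc : ∀ a k → range (suc a) k ≡ map suc (range a k)
range-suc a zero = refl
range-suc a (suc k) = cong (suc a ∷_) (range-suc (suc a) k)

∑-range-suc : ∀ a k (f : ℕ → ℕ) → ∑ (range (suc a) k) f ≡ ∑ (range a k) (f ∘ suc)
∑-range-suc a k f = trans (cong (λ r → ∑ r f) (range-suc a k)) (∑-map suc (range a k) f)

range-bounds : ∀ a k → All (λ s → a ≤ s × s < a + k) (range a k)
range-bounds a zero = []
range-bounds a (suc k) = (ℕ.≤-refl , ℕ.m<m+n a (s≤s z≤n))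
  ∷ All.map (λ {s} (a<s , s<) → ℕ.<⇒≤ a<s , subst (s <_) (sym (ℕ.+-suc a k)) s<) (range-bounds (suc a) k)

∑-oneTo-shift : ∀ n (f g : ℕ → ℕ) → f 1 ≡ 0 → g n ≡ 0 → (∀ s → 1 ≤ s → s < n → f (suc s) ≡ g s) →
  ∑ (oneTo n) f ≡ ∑ (oneTo n) g
∑-oneTo-shift zero f g _ _ _ = refl
∑-oneTo-shift (suc m) f g f1≡0 gn≡0 shift = begin
  f 1 + ∑ (range 2 m) f
    ≡⟨ cong₂ _+_ f1≡0 (∑-range-suc 1 m f) ⟩
  ∑ (oneTo m) (f ∘ suc)
    ≡⟨ ∑-cong-All (range-bounds 1 m) (λ s (1≤s , s<) → shift s 1≤s s<) ⟩
  ∑ (oneTo m) g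
    ≡⟨ sym (ℕ.+-identityʳ _) ⟩
  ∑ (oneTo m) g + 0
    ≡⟨ cong (∑ (oneTo m) g +_) (sym (trans (ℕ.+-identityʳ (g (suc m))) gn≡0)) ⟩
  ∑ (oneTo m) g + ∑ [ suc m ] g
    ≡⟨ sym (∑-++ (oneTo m) [ suc m ] g) ⟩
  ∑ (oneTo m ++ [ 1 + m ]) g
    ≡⟨ cong (λ r → ∑ r g) (sym (range-snoc 1 m)) ⟩
  ∑ (oneTo (suc m)) g ∎

words-All : {P : ℕ → Set} (vs : List ℕ) (n : ℕ) → All P vs → All (λ w → length w ≡ n × All P w) (words vs n)
words-All vs zero pvs = (refl , []) ∷ []
words-All vs (suc n) pvs =
  All.concat⁺ (All.map⁺ (All.map (λ pv → All.map⁺ (All.map (λ (len , pw) → cong suc len , pv ∷ pw) (words-All vs n pvs))) pvs))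

∑-words-snoc : (vs : List ℕ) (k : ℕ) (f : List ℕ → ℕ) →
  ∑ (words vs (suc k)) f ≡ ∑ (words vs k) (λ w → ∑ vs (λ v → f (w ++ [ v ])))
∑-words-snoc vs zero f = trans (∑-concatMap _ vs f) (trans (∑-cong vs (λ v → ℕ.+-identityʳ (f [ v ]))) (sym (ℕ.+-identityʳ _)))
∑-words-snoc vs (suc k) f = begin
  ∑ (words vs (suc (suc k))) f
    ≡⟨ ∑-concatMap _ vs f ⟩
  ∑ vs (λ v → ∑ (map (v ∷_) (words vs (suc k))) f)
    ≡⟨ ∑-cong vs (λ v → trans (∑-map (v ∷_) (words vs (suc k)) f) (∑-words-snoc vs k (f ∘ (v ∷_)))) ⟩
  ∑ vs (λ v → ∑ (words vs k) (λ w → ∑ vs (λ u → f (v ∷ (w ++ [ u ])))))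
    ≡⟨ ∑-cong vs (λ v → sym (∑-map (v ∷_) (words vs k) _)) ⟩
  ∑ vs (λ v → ∑ (map (v ∷_) (words vs k)) (λ w → ∑ vs (λ u → f (w ++ [ u ]))))
    ≡⟨ sym (∑-concatMap _ vs _) ⟩
  ∑ (words vs (suc k)) (λ w → ∑ vs (λ v → f (w ++ [ v ]))) ∎

words-singleton : ∀ y n → words [ y ] n ≡ [ replicate n y ]
words-singleton y zero = refl
words-singleton y (suc n) rewrite words-singleton y n = refl

-- The parking process

Occupancy : Set
Occupancy = ℕ → Bool

vacant : ℕ → Occupancy → ℕ → Bool
vacant n g t = (0 <ᵇ t) ∧ ((t <ᵇ suc n) ∧ not (g t))

taken : ℕ → Occupancy → ℕ → Bool
taken n g t = (0 <ᵇ t) ∧ ((t <ᵇ suc n) ∧ g t)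

spot : ℕ → Occupancy → ℕ → Maybe ℕ
spot n g a =
  if vacant n g a then just a
  else if vacant n g (a ∸ 1) ∧ (1 <ᵇ a) then just (a ∸ 1)
  else if vacant n g (suc a) then just (suc a)
  else nothing

occupy : Occupancy → ℕ → Occupancy
occupy g s i = (i ≡ᵇ s) ∨ g i

occupancy : List ℕ → Occupancy
occupancy L i = elem i L

carStep : ℕ → (Occupancy → ℕ) → Occupancy → ℕ
carStep n h g = ∑ (oneTo n) (λ a → maybe′ (h ∘ occupy g) 0 (spot n g a))

parkingSum : ℕ → ℕ → (Occupancy → ℕ) → ℕ
parkingSum n k h = ∑ (words (oneTo n) k) (λ α → maybe′ (h ∘ occupancy) 0 (parkAll n [] α))

parkAll-snoc : ∀ n occ α a → parkAll n occ (α ++ [ a ]) ≡ (parkAll n occ α >>= λ L → parkCar n L a)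
parkAll-snoc n occ [] a with parkCar n occ a
... | nothing = refl
... | just _ = refl
parkAll-snoc n occ (b ∷ α) a with parkCar n occ b
... | nothing = refl
... | just occ′ = parkAll-snoc n occ′ α a

parkCar-spot : ∀ n L a → parkCar n L a ≡ Maybe.map (_∷ L) (spot n (occupancy L) a)
parkCar-spot n L a with free n a L | free n (a ∸ 1) L ∧ (1 <ᵇ a) | free n (suc a) L
... | true | _ | _ = refl
... | false | true | _ = refl
... | false | false | true = refl
... | false | false | false = refl

parkingSum-suc : ∀ n k h → parkingSum n (suc k) h ≡ parkingSum n k (carStep n h)
parkingSum-suc n k h = trans (∑-words-snoc (oneTo n) k _) (∑-cong (words (oneTo n) k) lastCar)
  where
  lastCar : ∀ α → ∑ (oneTo n) (λ a → maybe′ (h ∘ occupancy) 0 (parkAll n [] (α ++ [ a ])))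
                  ≡ maybe′ (carStep n h ∘ occupancy) 0 (parkAll n [] α)
  lastCar α = trans (∑-cong (oneTo n) (λ a → cong (maybe′ (h ∘ occupancy) 0) (parkAll-snoc n [] α a)))
                    (afterParking (parkAll n [] α))
    where
    afterParking : ∀ r → ∑ (oneTo n) (λ a → maybe′ (h ∘ occupancy) 0 (r >>= λ L → parkCar n L a))
                         ≡ maybe′ (carStep n h ∘ occupancy) 0 r
    afterParking nothing = ∑-zero (oneTo n)
    afterParking (just L) =
      ∑-cong (oneTo n) (λ a → trans (cong (maybe′ (h ∘ occupancy) 0) (parkCar-spot n L a)) (parkOn (spot n (occupancy L) a)))
      where
      parkOn : ∀ r → maybe′ (h ∘ occupancy) 0 (Maybe.map (_∷ L) r) ≡ maybe′ (h ∘ occupy (occupancy L)) 0 r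
      parkOn nothing = refl
      parkOn (just s) = refl

vacant-cong : ∀ n {g g′} → g ≗ g′ → ∀ t → vacant n g t ≡ vacant n g′ t
vacant-cong n eq t = cong (λ b → (0 <ᵇ t) ∧ ((t <ᵇ suc n) ∧ not b)) (eq t)

spot-cong : ∀ n {g g′} → g ≗ g′ → ∀ a → spot n g a ≡ spot n g′ a
spot-cong n {g} {g′} eq a rewrite vacant-cong n eq a | vacant-cong n eq (a ∸ 1) | vacant-cong n eq (suc a) = refl

carStep-cong : ∀ n h → Congruent _≗_ _≡_ h → Congruent _≗_ _≡_ (carStep n h)
carStep-cong n h h-cong {g} {g′} eq =
  ∑-cong (oneTo n) (λ a → trans (cong (maybe′ (h ∘ occupy g) 0) (spot-cong n eq a)) (parkOn (spot n g′ a)))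
  where
  parkOn : ∀ r → maybe′ (h ∘ occupy g) 0 r ≡ maybe′ (h ∘ occupy g′) 0 r
  parkOn nothing = refl
  parkOn (just s) = h-cong (λ i → cong ((i ≡ᵇ s) ∨_) (eq i))

-- Where the next car lands

vacant-inRange : ∀ n g t → 1 ≤ t → t ≤ n → vacant n g t ≡ not (g t)
vacant-inRange n g (suc t) _ t<n rewrite <ᵇ-true {t} {n} t<n = refl

taken-inRange : ∀ n g t → 1 ≤ t → t ≤ n → taken n g t ≡ g t
taken-inRange n g (suc t) _ t<n rewrite <ᵇ-true {t} {n} t<n = refl

vacant-beyond : ∀ n g → vacant n g (suc n) ≡ false
vacant-beyond n g rewrite <ᵇ-false (ℕ.≤-refl {n}) = refl

taken-beyond : ∀ n g → taken n g (suc n) ≡ false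
taken-beyond n g rewrite <ᵇ-false (ℕ.≤-refl {n}) = refl

backsInto : ℕ → Occupancy → ℕ → Bool
backsInto n g s = taken n g (suc s)

advancesInto : ℕ → Occupancy → ℕ → Bool
advancesInto n g s = taken n g (s ∸ 1) ∧ ((s ≡ᵇ 2) ∨ taken n g (s ∸ 2))

-- A car lands on a vacant spot s from preference s, from s + 1 when that spot is taken (it
-- backs up), and from s − 1 when that spot is taken and the car cannot back up from it. The two
-- conditional summands are the paper's B̂ and F̂ of a largest letter at position s.
arrivals : ℕ → Occupancy → ℕ → ℕ
arrivals n g s = if vacant n g s then 𝟙 (backsInto n g s) + 𝟙 (advancesInto n g s) + 1 else 0

module CarStep (n : ℕ) (g : Occupancy) (H : ℕ → ℕ) where

  parksAt backsFrom advancesFrom : ℕ → ℕ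
  parksAt a = if vacant n g a then H a else 0
  backsFrom a = if not (vacant n g a) ∧ (vacant n g (a ∸ 1) ∧ (1 <ᵇ a)) then H (a ∸ 1) else 0
  advancesFrom a = if not (vacant n g a) ∧ (not (vacant n g (a ∸ 1) ∧ (1 <ᵇ a)) ∧ vacant n g (suc a)) then H (suc a) else 0

  backedInto advancedInto : ℕ → ℕ
  backedInto s = if vacant n g s ∧ backsInto n g s then H s else 0
  advancedInto s = if vacant n g s ∧ advancesInto n g s then H s else 0

  spot-split : ∀ a → maybe′ H 0 (spot n g a) ≡ parksAt a + backsFrom a + advancesFrom a
  spot-split a with vacant n g a | vacant n g (a ∸ 1) ∧ (1 <ᵇ a) | vacant n g (suc a)
  ... | true | _ | _ = sym (trans (ℕ.+-identityʳ _) (ℕ.+-identityʳ _))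
  ... | false | true | _ = sym (ℕ.+-identityʳ _)
  ... | false | false | true = refl
  ... | false | false | false = refl

  ∑-backsFrom : ∑ (oneTo n) backsFrom ≡ ∑ (oneTo n) backedInto
  ∑-backsFrom = ∑-oneTo-shift n backsFrom backedInto
    (if-false (H 0) (Bool.∧-zeroʳ (not (vacant n g 1))))
    (if-false (H n) (trans (cong (vacant n g n ∧_) (taken-beyond n g)) (Bool.∧-zeroʳ _)))
    shift
    where
    shift : ∀ s → 1 ≤ s → s < n → backsFrom (suc s) ≡ backedInto s
    shift (suc s) _ s<n rewrite vacant-inRange n g (2 + s) (s≤s z≤n) s<n | taken-inRange n g (2 + s) (s≤s z≤n) s<n =
      cong (λ b → if b then H (suc s) else 0)
        (trans (cong₂ _∧_ (Bool.not-involutive (g (2 + s))) (Bool.∧-identityʳ _)) (Bool.∧-comm (g (2 + s)) _))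

  ∑-advancesFrom : ∑ (oneTo n) advancesFrom ≡ ∑ (oneTo n) advancedInto
  ∑-advancesFrom = sym (∑-oneTo-shift n advancedInto advancesFrom
    (if-false (H 1) (Bool.∧-zeroʳ (vacant n g 1)))
    lastVacancy
    shift)
    where
    lastVacancy : advancesFrom n ≡ 0
    lastVacancy rewrite vacant-beyond n g =
      if-false (H (suc n)) (trans (cong (not (vacant n g n) ∧_) (Bool.∧-zeroʳ _)) (Bool.∧-zeroʳ _))
    shift : ∀ s → 1 ≤ s → s < n → advancedInto (suc s) ≡ advancesFrom s
    shift 1 _ 1<n rewrite vacant-inRange n g 1 (s≤s z≤n) (ℕ.<⇒≤ 1<n) | taken-inRange n g 1 (s≤s z≤n) (ℕ.<⇒≤ 1<n) =
      cong (λ b → if b then H 2 else 0) (bool (g 1) (vacant n g 2))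
      where
      bool : ∀ b v → v ∧ (b ∧ true) ≡ not (not b) ∧ v
      bool true true = refl
      bool true false = refl
      bool false v = Bool.∧-zeroʳ v
    shift (suc (suc s)) _ s<n
      rewrite vacant-inRange n g (2 + s) (s≤s z≤n) (ℕ.<⇒≤ s<n) | taken-inRange n g (2 + s) (s≤s z≤n) (ℕ.<⇒≤ s<n)
            | vacant-inRange n g (1 + s) (s≤s z≤n) (ℕ.<⇒≤ (ℕ.<⇒≤ s<n))
            | taken-inRange n g (1 + s) (s≤s z≤n) (ℕ.<⇒≤ (ℕ.<⇒≤ s<n)) =
      cong (λ b → if b then H (3 + s) else 0) (bool (g (1 + s)) (g (2 + s)) (vacant n g (3 + s)))
      where
      bool : ∀ b₁ b₂ v → v ∧ (b₂ ∧ (false ∨ b₁)) ≡ not (not b₂) ∧ (not (not b₁ ∧ true) ∧ v)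
      bool b₁ false v = Bool.∧-zeroʳ v
      bool false true v = Bool.∧-zeroʳ v
      bool true true v = Bool.∧-identityʳ v

  spot-contributions : ∀ s → parksAt s + backedInto s + advancedInto s ≡ arrivals n g s * H s
  spot-contributions s = indicator-split (vacant n g s) (backsInto n g s) (advancesInto n g s) (H s)

carStep-bySpot : ∀ n h g → carStep n h g ≡ ∑ (oneTo n) (λ s → arrivals n g s * h (occupy g s))
carStep-bySpot n h g = begin
  carStep n h g
    ≡⟨ ∑-cong (oneTo n) spot-split ⟩
  ∑ (oneTo n) (λ a → parksAt a + backsFrom a + advancesFrom a)
    ≡⟨ ∑-+₃ (oneTo n) parksAt backsFrom advancesFrom ⟩
  ∑ (oneTo n) parksAt + ∑ (oneTo n) backsFrom + ∑ (oneTo n) advancesFrom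
    ≡⟨ cong₂ (λ x y → ∑ (oneTo n) parksAt + x + y) ∑-backsFrom ∑-advancesFrom ⟩
  ∑ (oneTo n) parksAt + ∑ (oneTo n) backedInto + ∑ (oneTo n) advancedInto
    ≡⟨ sym (∑-+₃ (oneTo n) parksAt backedInto advancedInto) ⟩
  ∑ (oneTo n) (λ s → parksAt s + backedInto s + advancedInto s)
    ≡⟨ ∑-cong (oneTo n) spot-contributions ⟩
  ∑ (oneTo n) (λ s → arrivals n g s * h (occupy g s)) ∎
  where open CarStep n g (h ∘ occupy g)

-- Positions are 1-based, like spots; entry is 0 at position 0 and past the end.
entry : List ℕ → ℕ → ℕ
entry [] t = 0
entry (y ∷ w) zero = 0
entry (y ∷ w) 1 = y
entry (y ∷ w) (suc (suc t)) = entry w (suc t)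

support : List ℕ → Occupancy
support w i = not (entry w i ≡ᵇ 0)

fill : List ℕ → ℕ → ℕ → List ℕ
fill [] s x = []
fill (y ∷ w) zero x = y ∷ w
fill (y ∷ w) 1 x = x ∷ w
fill (y ∷ w) (suc (suc s)) x = y ∷ fill w (suc s) x

before : List ℕ → ℕ → List ℕ
before [] s = []
before (y ∷ w) zero = []
before (y ∷ w) 1 = []
before (y ∷ w) (suc (suc s)) = y ∷ before w (suc s)

after : List ℕ → ℕ → List ℕ
after [] s = []
after (y ∷ w) zero = y ∷ w
after (y ∷ w) 1 = w
after (y ∷ w) (suc (suc s)) = after w (suc s)

split-at : ∀ w s → 1 ≤ s → s ≤ length w → w ≡ before w s ++ entry w s ∷ after w s
split-at (y ∷ w) 1 _ _ = refl
split-at (y ∷ w) (suc (suc s)) _ (s≤s s<) = cong (y ∷_) (split-at w (suc s) (s≤s z≤n) s<)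

fill-split-at : ∀ w s x → 1 ≤ s → s ≤ length w → fill w s x ≡ before w s ++ x ∷ after w s
fill-split-at (y ∷ w) 1 x _ _ = refl
fill-split-at (y ∷ w) (suc (suc s)) x _ (s≤s s<) = cong (y ∷_) (fill-split-at w (suc s) x (s≤s z≤n) s<)

before-1 : ∀ w → before w 1 ≡ []
before-1 [] = refl
before-1 (y ∷ w) = refl

length-before : ∀ w s → s ≤ length w → length (before w (suc s)) ≡ s
length-before [] zero _ = refl
length-before (y ∷ w) zero _ = refl
length-before (y ∷ w) (suc s) (s≤s s≤) = cong suc (length-before w s s≤)

before-suc : ∀ w t → 1 ≤ t → t ≤ length w → before w (suc t) ≡ before w t ++ [ entry w t ]
before-suc (y ∷ w) 1 _ _ = cong (y ∷_) (before-1 w)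
before-suc (y ∷ w) (suc (suc t)) _ (s≤s t<) = cong (y ∷_) (before-suc w (suc t) (s≤s z≤n) t<)

entry-suc : ∀ w s → 1 ≤ s → entry w (suc s) ≡ entry (after w s) 1
entry-suc [] s _ = refl
entry-suc (y ∷ []) 1 _ = refl
entry-suc (y ∷ z ∷ w) 1 _ = refl
entry-suc (y ∷ w) (suc (suc s)) _ = entry-suc w (suc s) (s≤s z≤n)

entry-bound : ∀ {b} w t → All (_< suc b) w → entry w t < suc b
entry-bound [] t _ = s≤s z≤n
entry-bound (y ∷ w) zero _ = s≤s z≤n
entry-bound (y ∷ w) 1 (y< ∷ _) = y<
entry-bound (y ∷ w) (suc (suc t)) (_ ∷ w<) = entry-bound w (suc t) w<

entry-fill : ∀ w s x → 1 ≤ s → s ≤ length w → ∀ i → entry (fill w s x) i ≡ (if i ≡ᵇ s then x else entry w i)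
entry-fill (y ∷ w) 1 x _ _ zero = refl
entry-fill (y ∷ w) 1 x _ _ 1 = refl
entry-fill (y ∷ w) 1 x _ _ (suc (suc i)) = refl
entry-fill (y ∷ w) (suc (suc s)) x _ _ zero = refl
entry-fill (y ∷ w) (suc (suc s)) x _ _ 1 = refl
entry-fill (y ∷ w) (suc (suc s)) x _ (s≤s s<) (suc (suc i)) = entry-fill w (suc s) x (s≤s z≤n) s< (suc i)

entry-zeros : ∀ n i → entry (replicate n 0) i ≡ 0
entry-zeros zero i = refl
entry-zeros (suc n) zero = refl
entry-zeros (suc n) 1 = refl
entry-zeros (suc n) (suc (suc i)) = entry-zeros n (suc i)

support-fill : ∀ w s x → 1 ≤ s → s ≤ length w → support (fill w s (suc x)) ≗ occupy (support w) s
support-fill w s x 1≤s s≤ i rewrite entry-fill w s (suc x) 1≤s s≤ i with i ≡ᵇ s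
... | true = refl
... | false = refl

taken-support : ∀ w t → taken (length w) (support w) t ≡ support w t
taken-support [] zero = refl
taken-support [] (suc zero) = refl
taken-support [] (suc (suc t)) = refl
taken-support (y ∷ w) zero = refl
taken-support (y ∷ w) 1 = refl
taken-support (y ∷ w) (suc (suc t)) = taken-support w (suc t)

vacant-support : ∀ w s → 1 ≤ s → s ≤ length w → vacant (length w) (support w) s ≡ (entry w s ≡ᵇ 0)
vacant-support w s 1≤s s≤ = trans (vacant-inRange (length w) (support w) s 1≤s s≤) (Bool.not-involutive _)

letterFactor : List ℕ → ℕ → List ℕ → ℕ
letterFactor pre p suf = Bhat pre p suf + Fhat pre p suf + 1

-- Fhat is defined by `with` on Left; this is its clauses as a function, to rewrite along Left.
fhatFormula : ℕ → ℕ → ℕ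
fhatFormula zero i = 0
fhatFormula (suc l) i = if suc l ≡ᵇ i then (i ⊓ 1) else ((suc l ∸ 1) ⊓ 1) ⊔ 0

Fhat-viaLeft : ∀ pre q suf → Fhat pre (suc q) suf ≡ fhatFormula (Left (suc q) pre) (length pre)
Fhat-viaLeft pre q suf with Left (suc q) pre
... | zero = refl
... | suc l = refl

Fhat-suffix-irrelevant : ∀ pre p suf suf′ → Fhat pre p suf ≡ Fhat pre p suf′
Fhat-suffix-irrelevant pre zero suf suf′ = refl
Fhat-suffix-irrelevant pre (suc q) suf suf′ = trans (Fhat-viaLeft pre q suf) (sym (Fhat-viaLeft pre q suf′))

run-blocked : ∀ p x C D → p ≤ x → run p (C ++ x ∷ D) ≡ run p (C ++ 0 ∷ D)
run-blocked p x [] D p≤x rewrite <ᵇ-false p≤x | Bool.∧-zeroʳ (0 <ᵇ x) = refl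
run-blocked p x (c ∷ C) D p≤x = cong (λ r → if (0 <ᵇ c) ∧ (c <ᵇ p) then suc r else 0) (run-blocked p x C D p≤x)

reverse-middle : ∀ (C D : List ℕ) x → reverse (C ++ x ∷ D) ≡ reverse D ++ x ∷ reverse C
reverse-middle C D x =
  trans (List.reverse-++ C (x ∷ D)) (trans (cong (_++ reverse C) (List.unfold-reverse x D)) (List.++-assoc (reverse D) [ x ] (reverse C)))

Left-blocked : ∀ p x C D → p ≤ x → Left p (C ++ x ∷ D) ≡ Left p (C ++ 0 ∷ D)
Left-blocked p x C D p≤x = begin
  run p (reverse (C ++ x ∷ D))  ≡⟨ cong (run p) (reverse-middle C D x) ⟩
  run p (reverse D ++ x ∷ reverse C)  ≡⟨ run-blocked p x (reverse D) (reverse C) p≤x ⟩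
  run p (reverse D ++ 0 ∷ reverse C)  ≡⟨ cong (run p) (sym (reverse-middle C D 0)) ⟩
  run p (reverse (C ++ 0 ∷ D)) ∎

weightGo-blocked : ∀ x C D r → All (_≤ x) r → weightGo (C ++ x ∷ D) r ≡ weightGo (C ++ 0 ∷ D) r
weightGo-blocked x C D [] _ = refl
weightGo-blocked x C D (p ∷ r) (p≤x ∷ r≤x) =
  cong₂ _*_ (cong₂ (λ b f → b + f + 1) (Bhat-prefix-irrelevant p) (Fhat-blocked p p≤x)) rest
  where
  Bhat-prefix-irrelevant : ∀ p → Bhat (C ++ x ∷ D) p r ≡ Bhat (C ++ 0 ∷ D) p r
  Bhat-prefix-irrelevant zero = refl
  Bhat-prefix-irrelevant (suc _) = refl
  Fhat-blocked : ∀ p → p ≤ x → Fhat (C ++ x ∷ D) p r ≡ Fhat (C ++ 0 ∷ D) p r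
  Fhat-blocked zero _ = refl
  Fhat-blocked (suc p) p<x = begin
    Fhat (C ++ x ∷ D) (suc p) r
      ≡⟨ Fhat-viaLeft (C ++ x ∷ D) p r ⟩
    fhatFormula (Left (suc p) (C ++ x ∷ D)) (length (C ++ x ∷ D))
      ≡⟨ cong₂ fhatFormula (Left-blocked (suc p) x C D p<x) (trans (List.length-++ C) (sym (List.length-++ C))) ⟩
    fhatFormula (Left (suc p) (C ++ 0 ∷ D)) (length (C ++ 0 ∷ D))
      ≡⟨ sym (Fhat-viaLeft (C ++ 0 ∷ D) p r) ⟩
    Fhat (C ++ 0 ∷ D) (suc p) r ∎
  rest : weightGo ((C ++ x ∷ D) ++ [ p ]) r ≡ weightGo ((C ++ 0 ∷ D) ++ [ p ]) r
  rest rewrite List.++-assoc C (x ∷ D) [ p ] | List.++-assoc C (0 ∷ D) [ p ] = weightGo-blocked x C (D ++ [ p ]) r r≤x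

letterFactor-blocked : ∀ pre y x l₁ l₂ → y ≤ x → letterFactor pre y (l₁ ++ x ∷ l₂) ≡ letterFactor pre y (l₁ ++ 0 ∷ l₂)
letterFactor-blocked pre y x l₁ l₂ y≤x =
  cong₂ (λ b f → b + f + 1) (Bhat-blocked y y≤x) (Fhat-suffix-irrelevant pre y (l₁ ++ x ∷ l₂) (l₁ ++ 0 ∷ l₂))
  where
  Bhat-blocked : ∀ y → y ≤ x → Bhat pre y (l₁ ++ x ∷ l₂) ≡ Bhat pre y (l₁ ++ 0 ∷ l₂)
  Bhat-blocked zero _ = refl
  Bhat-blocked (suc y) y<x = cong (_⊓ 1) (run-blocked (suc y) x l₁ l₂ y<x)

-- Every other letter y ≤ x sees x in its Left and Right runs exactly as it saw the 0: both end
-- the run. So only the factor of x itself is new.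
weightGo-replace-zero : ∀ x pre l₁ l₂ → All (_≤ x) l₁ → All (_≤ x) l₂ →
  weightGo pre (l₁ ++ x ∷ l₂) ≡ weightGo pre (l₁ ++ 0 ∷ l₂) * letterFactor (pre ++ l₁) x l₂
weightGo-replace-zero x pre [] l₂ _ l₂≤x = begin
  letterFactor pre x l₂ * weightGo (pre ++ [ x ]) l₂
    ≡⟨ cong (letterFactor pre x l₂ *_) (weightGo-blocked x pre [] l₂ l₂≤x) ⟩
  letterFactor pre x l₂ * weightGo (pre ++ [ 0 ]) l₂
    ≡⟨ ℕ.*-comm (letterFactor pre x l₂) _ ⟩
  weightGo (pre ++ [ 0 ]) l₂ * letterFactor pre x l₂
    ≡⟨ cong₂ _*_ (sym (ℕ.*-identityˡ (weightGo (pre ++ [ 0 ]) l₂)))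
                 (cong (λ p → letterFactor p x l₂) (sym (List.++-identityʳ pre))) ⟩
  weightGo pre (0 ∷ l₂) * letterFactor (pre ++ []) x l₂ ∎
weightGo-replace-zero x pre (y ∷ l₁) l₂ (y≤x ∷ l₁≤x) l₂≤x = begin
  letterFactor pre y (l₁ ++ x ∷ l₂) * weightGo (pre ++ [ y ]) (l₁ ++ x ∷ l₂)
    ≡⟨ cong₂ _*_ (letterFactor-blocked pre y x l₁ l₂ y≤x) (weightGo-replace-zero x (pre ++ [ y ]) l₁ l₂ l₁≤x l₂≤x) ⟩
  letterFactor pre y (l₁ ++ 0 ∷ l₂) * (weightGo (pre ++ [ y ]) (l₁ ++ 0 ∷ l₂) * letterFactor ((pre ++ [ y ]) ++ l₁) x l₂)
    ≡⟨ sym (ℕ.*-assoc (letterFactor pre y (l₁ ++ 0 ∷ l₂)) _ _) ⟩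
  weightGo pre (y ∷ l₁ ++ 0 ∷ l₂) * letterFactor ((pre ++ [ y ]) ++ l₁) x l₂
    ≡⟨ cong (λ p → weightGo pre (y ∷ l₁ ++ 0 ∷ l₂) * letterFactor p x l₂) (List.++-assoc pre [ y ] l₁) ⟩
  weightGo pre (y ∷ l₁ ++ 0 ∷ l₂) * letterFactor (pre ++ y ∷ l₁) x l₂ ∎

weightGo-zeros : ∀ pre n → weightGo pre (replicate n 0) ≡ 1
weightGo-zeros pre zero = refl
weightGo-zeros pre (suc n) = cong (_+ 0) (weightGo-zeros (pre ++ [ 0 ]) n)

fillFactor : List ℕ → ℕ → ℕ
fillFactor w s = 𝟙 (support w (suc s)) + 𝟙 (support w (s ∸ 1) ∧ ((s ≡ᵇ 2) ∨ support w (s ∸ 2))) + 1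

Bhat-max : ∀ q pre r → All (_< suc q) r → Bhat pre (suc q) r ≡ 𝟙 (support r 1)
Bhat-max q pre [] _ = refl
Bhat-max q pre (zero ∷ r) _ = refl
Bhat-max q pre (suc y ∷ r) (y<q ∷ _) rewrite <ᵇ-true y<q = cong suc (ℕ.⊓-zeroʳ _)

fhatFormula-run : ∀ q a b r i → a < suc q → b < suc q →
  fhatFormula (run (suc q) (a ∷ b ∷ r)) (2 + i) ≡ 𝟙 (not (a ≡ᵇ 0) ∧ (false ∨ not (b ≡ᵇ 0)))
fhatFormula-run q zero b r i _ _ = refl
fhatFormula-run q (suc a) zero r i a<q _ rewrite <ᵇ-true a<q = refl
fhatFormula-run q (suc a) (suc b) r i a<q b<q rewrite <ᵇ-true a<q | <ᵇ-true b<q = atLeastOne (run (suc q) r)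
  where
  atLeastOne : ∀ l → (if l ≡ᵇ i then 1 else ((suc l ⊓ 1) ⊔ 0)) ≡ 1
  atLeastOne l rewrite ℕ.⊓-zeroʳ l with l ≡ᵇ i
  ... | true = refl
  ... | false = refl

Fhat-max : ∀ q w s → All (_< suc q) w → 1 ≤ s → s ≤ length w → ∀ suf →
  Fhat (before w s) (suc q) suf ≡ 𝟙 (support w (s ∸ 1) ∧ ((s ≡ᵇ 2) ∨ support w (s ∸ 2)))
Fhat-max q (y ∷ w) 1 _ _ _ suf = refl
Fhat-max q (zero ∷ w) 2 _ _ _ suf rewrite before-1 w = refl
Fhat-max q (suc y ∷ w) 2 (y<q ∷ _) _ _ suf rewrite before-1 w | <ᵇ-true y<q = refl
Fhat-max q w (suc (suc (suc s))) w<q _ s< suf = begin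
  Fhat (before w (3 + s)) (suc q) suf
    ≡⟨ Fhat-viaLeft (before w (3 + s)) q suf ⟩
  fhatFormula (run (suc q) (reverse (before w (3 + s)))) (length (before w (3 + s)))
    ≡⟨ cong₂ fhatFormula (cong (run (suc q)) reversed) (length-before w (2 + s) (ℕ.<⇒≤ s<)) ⟩
  fhatFormula (run (suc q) (entry w (2 + s) ∷ entry w (1 + s) ∷ reverse (before w (1 + s)))) (2 + s)
    ≡⟨ fhatFormula-run q (entry w (2 + s)) (entry w (1 + s)) (reverse (before w (1 + s))) s (entry-bound w _ w<q) (entry-bound w _ w<q) ⟩
  𝟙 (support w (2 + s) ∧ (false ∨ support w (1 + s))) ∎
  where
  snoc-reverse : ∀ t → 1 ≤ t → t ≤ length w → reverse (before w (suc t)) ≡ entry w t ∷ reverse (before w t)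
  snoc-reverse t 1≤t t≤ = trans (cong reverse (before-suc w t 1≤t t≤)) (List.reverse-++ (before w t) [ entry w t ])
  reversed : reverse (before w (3 + s)) ≡ entry w (2 + s) ∷ entry w (1 + s) ∷ reverse (before w (1 + s))
  reversed = trans (snoc-reverse (2 + s) (s≤s z≤n) (ℕ.<⇒≤ s<))
                   (cong (entry w (2 + s) ∷_) (snoc-reverse (1 + s) (s≤s z≤n) (ℕ.<⇒≤ (ℕ.<⇒≤ s<))))

weight-fill : ∀ q w s → All (_< suc q) w → 1 ≤ s → s ≤ length w → entry w s ≡ 0 →
  weight (fill w s (suc q)) ≡ weight w * fillFactor w s
weight-fill q w s w<q 1≤s s≤ ws≡0 = begin
  weightGo [] (fill w s (suc q))
    ≡⟨ cong (weightGo []) (fill-split-at w s (suc q) 1≤s s≤) ⟩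
  weightGo [] (P ++ suc q ∷ Q)
    ≡⟨ weightGo-replace-zero (suc q) [] P Q (All.map ℕ.<⇒≤ P<q) (All.map ℕ.<⇒≤ Q<q) ⟩
  weightGo [] (P ++ 0 ∷ Q) * letterFactor P (suc q) Q
    ≡⟨ cong₂ _*_ (cong (weightGo []) (sym w≡P0Q)) (cong₂ (λ b f → b + f + 1) Bhat-fill (Fhat-max q w s w<q 1≤s s≤ Q)) ⟩
  weight w * fillFactor w s ∎
  where
  P = before w s
  Q = after w s
  w≡P0Q : w ≡ P ++ 0 ∷ Q
  w≡P0Q = trans (split-at w s 1≤s s≤) (cong (λ z → P ++ z ∷ Q) ws≡0)
  P0Q<q : All (_< suc q) (P ++ 0 ∷ Q)
  P0Q<q = subst (All (_< suc q)) w≡P0Q w<q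
  P<q : All (_< suc q) P
  P<q = All.++⁻ˡ P P0Q<q
  Q<q : All (_< suc q) Q
  Q<q = All.tail (All.++⁻ʳ P P0Q<q)
  Bhat-fill : Bhat P (suc q) Q ≡ 𝟙 (support w (suc s))
  Bhat-fill = trans (Bhat-max q P Q Q<q) (cong (λ e → 𝟙 (not (e ≡ᵇ 0))) (sym (entry-suc w s 1≤s)))

arrivals-support : ∀ w s → 1 ≤ s → s ≤ length w →
  arrivals (length w) (support w) s ≡ (if entry w s ≡ᵇ 0 then fillFactor w s else 0)
arrivals-support w s 1≤s s≤ = cong₂ (λ v a → if v then a else 0) (vacant-support w s 1≤s s≤)
  (cong₂ (λ b f → 𝟙 b + 𝟙 f + 1) (taken-support w (suc s))
    (cong₂ (λ b c → b ∧ ((s ≡ᵇ 2) ∨ c)) (taken-support w (s ∸ 1)) (taken-support w (s ∸ 2))))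

-- Filling a zero with a new largest letter

fills : ℕ → List ℕ → List (List ℕ)
fills x [] = []
fills x (zero ∷ w) = (x ∷ w) ∷ map (0 ∷_) (fills x w)
fills x (suc y ∷ w) = map (suc y ∷_) (fills x w)

∑-fills-∷ : ∀ x v w (F : List ℕ → ℕ) →
  ∑ (fills x (v ∷ w)) F ≡ (if v ≡ᵇ 0 then F (x ∷ w) else 0) + ∑ (fills x w) (F ∘ (v ∷_))
∑-fills-∷ x zero w F = cong (F (x ∷ w) +_) (∑-map (0 ∷_) (fills x w) F)
∑-fills-∷ x (suc v) w F = ∑-map (suc v ∷_) (fills x w) F

∑-fills : ∀ x w (G : List ℕ → ℕ) →
  ∑ (fills x w) G ≡ ∑ (oneTo (length w)) (λ s → if entry w s ≡ᵇ 0 then G (fill w s x) else 0)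
∑-fills x [] G = refl
∑-fills x (v ∷ w) G = trans (∑-fills-∷ x v w G) (cong ((if v ≡ᵇ 0 then G (x ∷ w) else 0) +_) (begin
  ∑ (fills x w) (G ∘ (v ∷_))
    ≡⟨ ∑-fills x w (G ∘ (v ∷_)) ⟩
  ∑ (oneTo (length w)) (λ s → if entry w s ≡ᵇ 0 then G (v ∷ fill w s x) else 0)
    ≡⟨ ∑-cong-All (range-bounds 1 (length w)) (λ { (suc s) _ → refl }) ⟩
  ∑ (oneTo (length w)) (λ s → if entry (v ∷ w) (suc s) ≡ᵇ 0 then G (fill (v ∷ w) (suc s) x) else 0)
    ≡⟨ sym (∑-range-suc 1 (length w) _) ⟩
  ∑ (range 2 (length w)) (λ s → if entry (v ∷ w) s ≡ᵇ 0 then G (fill (v ∷ w) s x) else 0) ∎))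

∑-fills-weight : ∀ q w h → Congruent _≗_ _≡_ h → All (_< suc q) w →
  ∑ (fills (suc q) w) (λ u → weight u * h (support u)) ≡ weight w * carStep (length w) h (support w)
∑-fills-weight q w h h-cong w<q = begin
  ∑ (fills (suc q) w) (λ u → weight u * h (support u))
    ≡⟨ ∑-fills (suc q) w _ ⟩
  ∑ (oneTo n) (λ s → if entry w s ≡ᵇ 0 then weight (fill w s (suc q)) * h (support (fill w s (suc q))) else 0)
    ≡⟨ ∑-cong-All (range-bounds 1 n) (λ s (1≤s , s<) → atSpot s 1≤s (ℕ.≤-pred s<)) ⟩
  ∑ (oneTo n) (λ s → weight w * (arrivals n (support w) s * h (occupy (support w) s)))
    ≡⟨ ∑-*ˡ (oneTo n) (weight w) _ ⟩
  weight w * ∑ (oneTo n) (λ s → arrivals n (support w) s * h (occupy (support w) s))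
    ≡⟨ cong (weight w *_) (sym (carStep-bySpot n h (support w))) ⟩
  weight w * carStep n h (support w) ∎
  where
  n = length w
  atSpot : ∀ s → 1 ≤ s → s ≤ n →
    (if entry w s ≡ᵇ 0 then weight (fill w s (suc q)) * h (support (fill w s (suc q))) else 0)
      ≡ weight w * (arrivals n (support w) s * h (occupy (support w) s))
  atSpot s 1≤s s≤ rewrite arrivals-support w s 1≤s s≤ with entry w s in ws≡
  ... | zero = trans (cong₂ _*_ (weight-fill q w s w<q 1≤s s≤ ws≡) (h-cong (support-fill w s q 1≤s s≤)))
                     (ℕ.*-assoc (weight w) _ _)
  ... | suc _ = sym (ℕ.*-zeroʳ (weight w))

ZeroReplaced : ℕ → List ℕ → List ℕ → Set
ZeroReplaced x w u = ∀ v → count v u + 𝟙 (v ≡ᵇ 0) ≡ count v w + 𝟙 (v ≡ᵇ x)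

ZeroReplaced-∷ : ∀ {x w u} y → ZeroReplaced x w u → ZeroReplaced x (y ∷ w) (y ∷ u)
ZeroReplaced-∷ {w = w} {u = u} y eq v =
  trans (ℕ.+-assoc (𝟙 (v ≡ᵇ y)) (count v u) _)
    (trans (cong (𝟙 (v ≡ᵇ y) +_) (eq v)) (sym (ℕ.+-assoc (𝟙 (v ≡ᵇ y)) (count v w) _)))

fills-ZeroReplaced : ∀ x w → All (ZeroReplaced x w) (fills x w)
fills-ZeroReplaced x [] = []
fills-ZeroReplaced x (zero ∷ w) = swapped ∷ All.map⁺ (All.map (λ {u} → ZeroReplaced-∷ {x} {w} {u} 0) (fills-ZeroReplaced x w))
  where
  swapped : ZeroReplaced x (0 ∷ w) (x ∷ w)
  swapped v = swap (𝟙 (v ≡ᵇ x)) (count v w) (𝟙 (v ≡ᵇ 0))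
    where
    swap : ∀ a b c → a + b + c ≡ c + b + a
    swap = solve-∀
fills-ZeroReplaced x (suc y ∷ w) = All.map⁺ (All.map (λ {u} → ZeroReplaced-∷ {x} {w} {u} (suc y)) (fills-ZeroReplaced x w))

-- The recursion for 𝔖

∑-words-avoiding : ∀ vs x → All (λ v → (x ≡ᵇ v) ≡ false) vs → ∀ n (F : List ℕ → ℕ) →
  ∑ (words (vs ++ [ x ]) n) (λ w → if count x w ≡ᵇ 0 then F w else 0) ≡ ∑ (words vs n) F
∑-words-avoiding vs x x∉vs zero F = refl
∑-words-avoiding vs x x∉vs (suc n) F = begin
  ∑ (words vs′ (suc n)) K
    ≡⟨ trans (∑-concatMap _ vs′ K) (∑-++ vs [ x ] _) ⟩
  ∑ vs (λ v → ∑ (map (v ∷_) (words vs′ n)) K) + (∑ (map (x ∷_) (words vs′ n)) K + 0)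
    ≡⟨ cong₂ _+_ (∑-cong-All x∉vs startsInVs) (cong (_+ 0) startsWithX) ⟩
  ∑ vs (λ v → ∑ (words vs n) (F ∘ (v ∷_))) + 0
    ≡⟨ ℕ.+-identityʳ _ ⟩
  ∑ vs (λ v → ∑ (words vs n) (F ∘ (v ∷_)))
    ≡⟨ sym (trans (∑-concatMap _ vs F) (∑-cong vs (λ v → ∑-map (v ∷_) (words vs n) F))) ⟩
  ∑ (words vs (suc n)) F ∎
  where
  vs′ = vs ++ [ x ]
  K : List ℕ → ℕ
  K w = if count x w ≡ᵇ 0 then F w else 0
  startsInVs : ∀ v → (x ≡ᵇ v) ≡ false → ∑ (map (v ∷_) (words vs′ n)) K ≡ ∑ (words vs n) (F ∘ (v ∷_))
  startsInVs v x≢v = trans (∑-map (v ∷_) (words vs′ n) K)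
    (trans (∑-cong (words vs′ n) (λ w → cong (λ b → if 𝟙 b + count x w ≡ᵇ 0 then F (v ∷ w) else 0) x≢v))
           (∑-words-avoiding vs x x∉vs n (F ∘ (v ∷_))))
  startsWithX : ∑ (map (x ∷_) (words vs′ n)) K ≡ 0
  startsWithX = trans (∑-map (x ∷_) (words vs′ n) K)
    (trans (∑-cong (words vs′ n) (λ w → cong (λ b → if 𝟙 b + count x w ≡ᵇ 0 then F (x ∷ w) else 0) (≡ᵇ-refl x)))
           (∑-zero (words vs′ n)))

∑-words-once : ∀ vs x → All (λ v → (x ≡ᵇ v) ≡ false) vs → (∀ c → ∑ vs (λ v → if v ≡ᵇ 0 then c else 0) ≡ c) →
  ∀ n (F : List ℕ → ℕ) →
  ∑ (words (vs ++ [ x ]) n) (λ w → if count x w ≡ᵇ 1 then F w else 0) ≡ ∑ (words vs n) (λ w → ∑ (fills x w) F)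
∑-words-once vs x x∉vs zeroOnce zero F = refl
∑-words-once vs x x∉vs zeroOnce (suc n) F = begin
  ∑ (words vs′ (suc n)) K
    ≡⟨ trans (∑-concatMap _ vs′ K) (∑-++ vs [ x ] _) ⟩
  ∑ vs (λ v → ∑ (map (v ∷_) (words vs′ n)) K) + (∑ (map (x ∷_) (words vs′ n)) K + 0)
    ≡⟨ cong₂ _+_ (∑-cong-All x∉vs startsInVs) (trans (ℕ.+-identityʳ _) startsWithX) ⟩
  ∑ vs (λ v → ∑ (words vs n) (later v)) + ∑ (words vs n) (F ∘ (x ∷_))
    ≡⟨ ℕ.+-comm (∑ vs (λ v → ∑ (words vs n) (later v))) _ ⟩
  ∑ (words vs n) (F ∘ (x ∷_)) + ∑ vs (λ v → ∑ (words vs n) (later v))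
    ≡⟨ cong (_+ ∑ vs (λ v → ∑ (words vs n) (later v)))
            (sym (trans (∑-cong vs (λ v → ∑-if (words vs n) (v ≡ᵇ 0) _)) (zeroOnce _))) ⟩
  ∑ vs (λ v → ∑ (words vs n) (first v)) + ∑ vs (λ v → ∑ (words vs n) (later v))
    ≡⟨ sym (trans (∑-cong vs (λ v → ∑-+ (words vs n) (first v) (later v))) (∑-+ vs _ _)) ⟩
  ∑ vs (λ v → ∑ (words vs n) (λ w → first v w + later v w))
    ≡⟨ ∑-cong vs (λ v → ∑-cong (words vs n) (λ w → sym (∑-fills-∷ x v w F))) ⟩
  ∑ vs (λ v → ∑ (words vs n) (λ w → ∑ (fills x (v ∷ w)) F))
    ≡⟨ sym (trans (∑-concatMap _ vs _) (∑-cong vs (λ v → ∑-map (v ∷_) (words vs n) _))) ⟩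
  ∑ (words vs (suc n)) (λ w → ∑ (fills x w) F) ∎
  where
  vs′ = vs ++ [ x ]
  K : List ℕ → ℕ
  K w = if count x w ≡ᵇ 1 then F w else 0
  first later : ℕ → List ℕ → ℕ
  first v w = if v ≡ᵇ 0 then F (x ∷ w) else 0
  later v w = ∑ (fills x w) (F ∘ (v ∷_))
  startsInVs : ∀ v → (x ≡ᵇ v) ≡ false → ∑ (map (v ∷_) (words vs′ n)) K ≡ ∑ (words vs n) (later v)
  startsInVs v x≢v = trans (∑-map (v ∷_) (words vs′ n) K)
    (trans (∑-cong (words vs′ n) (λ w → cong (λ b → if 𝟙 b + count x w ≡ᵇ 1 then F (v ∷ w) else 0) x≢v))
           (∑-words-once vs x x∉vs zeroOnce n (F ∘ (v ∷_))))
  startsWithX : ∑ (map (x ∷_) (words vs′ n)) K ≡ ∑ (words vs n) (F ∘ (x ∷_))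
  startsWithX = trans (∑-map (x ∷_) (words vs′ n) K)
    (trans (∑-cong (words vs′ n) (λ w → cong (λ b → if 𝟙 b + count x w ≡ᵇ 1 then F (x ∷ w) else 0) (≡ᵇ-refl x)))
           (∑-words-avoiding vs x x∉vs n (F ∘ (x ∷_))))

count-++ : ∀ v (xs ys : List ℕ) → count v (xs ++ ys) ≡ count v xs + count v ys
count-++ v [] ys = refl
count-++ v (x ∷ xs) ys = trans (cong (𝟙 (v ≡ᵇ x) +_) (count-++ v xs ys)) (sym (ℕ.+-assoc (𝟙 (v ≡ᵇ x)) _ _))

count-replicate-0 : ∀ v j → count v (replicate j 0) ≡ (if v ≡ᵇ 0 then j else 0)
count-replicate-0 zero zero = refl
count-replicate-0 zero (suc j) = cong suc (count-replicate-0 zero j)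
count-replicate-0 (suc v) zero = refl
count-replicate-0 (suc v) (suc j) = count-replicate-0 (suc v) j

count-range-below : ∀ v a j → v < a → count v (range a j) ≡ 0
count-range-below v a zero _ = refl
count-range-below v a (suc j) v<a rewrite <⇒≡ᵇ-false v<a = count-range-below v (suc a) j (ℕ.m≤n⇒m≤1+n v<a)

count-range-above : ∀ v a j → a + j ≤ v → count v (range a j) ≡ 0
count-range-above v a zero _ = refl
count-range-above v a (suc j) a+j<v rewrite >⇒≡ᵇ-false {v} {a} (ℕ.<-≤-trans (ℕ.m<m+n a (s≤s z≤n)) a+j<v) =
  count-range-above v (suc a) j (subst (_≤ v) (ℕ.+-suc a j) a+j<v)

count-base-zero : ∀ m n → count 0 (baseMultiset m n) ≡ n ∸ m
count-base-zero m n = begin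
  count 0 (replicate (n ∸ m) 0 ++ oneTo m)
    ≡⟨ count-++ 0 (replicate (n ∸ m) 0) (oneTo m) ⟩
  count 0 (replicate (n ∸ m) 0) + count 0 (oneTo m)
    ≡⟨ cong₂ _+_ (count-replicate-0 0 (n ∸ m)) (count-range-below 0 1 m (s≤s z≤n)) ⟩
  n ∸ m + 0
    ≡⟨ ℕ.+-identityʳ _ ⟩
  n ∸ m ∎

count-base-positive : ∀ v k n → count (suc v) (baseMultiset (suc k) n) ≡ count (suc v) (oneTo k) + 𝟙 (v ≡ᵇ k)
count-base-positive v k n = begin
  count (suc v) (replicate (n ∸ suc k) 0 ++ oneTo (suc k))
    ≡⟨ count-++ (suc v) (replicate (n ∸ suc k) 0) _ ⟩
  count (suc v) (replicate (n ∸ suc k) 0) + count (suc v) (oneTo (suc k))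
    ≡⟨ cong₂ _+_ (count-replicate-0 (suc v) (n ∸ suc k)) (cong (count (suc v)) (range-snoc 1 k)) ⟩
  count (suc v) (oneTo k ++ [ suc k ])
    ≡⟨ count-++ (suc v) (oneTo k) [ suc k ] ⟩
  count (suc v) (oneTo k) + (𝟙 (v ≡ᵇ k) + 0)
    ≡⟨ cong (count (suc v) (oneTo k) +_) (ℕ.+-identityʳ _) ⟩
  count (suc v) (oneTo k) + 𝟙 (v ≡ᵇ k) ∎

count-base-new : ∀ k n → count (suc k) (baseMultiset (suc k) n) ≡ 1
count-base-new k n =
  trans (count-base-positive k k n) (cong₂ (λ c b → c + 𝟙 b) (count-range-above (suc k) 1 k ℕ.≤-refl) (≡ᵇ-refl k))

count-base-old : ∀ k n v → v < suc k → suc k ≤ n →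
  count v (baseMultiset (suc k) n) + 𝟙 (v ≡ᵇ 0) ≡ count v (baseMultiset k n)
count-base-old k n zero _ k<n = begin
  count 0 (baseMultiset (suc k) n) + 1
    ≡⟨ cong (_+ 1) (count-base-zero (suc k) n) ⟩
  n ∸ suc k + 1
    ≡⟨ cong (_+ 1) (sym (trans (ℕ.∸-+-assoc n k 1) (cong (n ∸_) (ℕ.+-comm k 1)))) ⟩
  n ∸ k ∸ 1 + 1
    ≡⟨ ℕ.m∸n+n≡m (ℕ.m<n⇒0<n∸m k<n) ⟩
  n ∸ k
    ≡⟨ sym (count-base-zero k n) ⟩
  count 0 (baseMultiset k n) ∎
count-base-old k n (suc v) (s≤s v<k) _ = begin
  count (suc v) (baseMultiset (suc k) n) + 0
    ≡⟨ ℕ.+-identityʳ _ ⟩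
  count (suc v) (baseMultiset (suc k) n)
    ≡⟨ count-base-positive v k n ⟩
  count (suc v) (oneTo k) + 𝟙 (v ≡ᵇ k)
    ≡⟨ cong (λ b → count (suc v) (oneTo k) + 𝟙 b) (<⇒≡ᵇ-false v<k) ⟩
  count (suc v) (oneTo k) + 0
    ≡⟨ ℕ.+-identityʳ _ ⟩
  count (suc v) (oneTo k)
    ≡⟨ sym (trans (count-++ (suc v) (replicate (n ∸ k) 0) (oneTo k))
                  (cong (_+ count (suc v) (oneTo k)) (count-replicate-0 (suc v) (n ∸ k)))) ⟩
  count (suc v) (baseMultiset k n) ∎

allB-++ : ∀ p (xs ys : List ℕ) → allB p (xs ++ ys) ≡ allB p xs ∧ allB p ys
allB-++ p [] ys = refl
allB-++ p (x ∷ xs) ys = trans (cong (p x ∧_) (allB-++ p xs ys)) (sym (Bool.∧-assoc (p x) _ _))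

allB-cong-All : ∀ {p q} {xs : List ℕ} → All (λ v → p v ≡ q v) xs → allB p xs ≡ allB q xs
allB-cong-All [] = refl
allB-cong-All (eq ∷ eqs) = cong₂ _∧_ eq (allB-cong-All eqs)

module _ (k n : ℕ) where

  countMatches : List ℕ → ℕ → Bool
  countMatches u v = count v u ≡ᵇ count v (baseMultiset (suc k) n)

  hasOldCounts : List ℕ → Bool
  hasOldCounts u = allB (countMatches u) (range 0 (suc k))

  isPermOfBase-suc : ∀ u → isPermOfBase (suc k) n u ≡ (count (suc k) u ≡ᵇ 1) ∧ hasOldCounts u
  isPermOfBase-suc u = begin
    allB (countMatches u) (range 0 (suc (suc k)))
      ≡⟨ cong (allB (countMatches u)) (range-snoc 0 (suc k)) ⟩
    allB (countMatches u) (range 0 (suc k) ++ [ suc k ])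
      ≡⟨ allB-++ (countMatches u) (range 0 (suc k)) [ suc k ] ⟩
    hasOldCounts u ∧ ((count (suc k) u ≡ᵇ count (suc k) (baseMultiset (suc k) n)) ∧ true)
      ≡⟨ cong (λ c → hasOldCounts u ∧ ((count (suc k) u ≡ᵇ c) ∧ true)) (count-base-new k n) ⟩
    hasOldCounts u ∧ ((count (suc k) u ≡ᵇ 1) ∧ true)
      ≡⟨ trans (cong (hasOldCounts u ∧_) (Bool.∧-identityʳ _)) (Bool.∧-comm (hasOldCounts u) _) ⟩
    (count (suc k) u ≡ᵇ 1) ∧ hasOldCounts u ∎

  hasOldCounts-fill : suc k ≤ n → ∀ w u → ZeroReplaced (suc k) w u → hasOldCounts u ≡ isPermOfBase k n w
  hasOldCounts-fill k<n w u eq = allB-cong-All (All.map (λ {v} (_ , v<) → sameTest v v<) (range-bounds 0 (suc k)))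
    where
    sameTest : ∀ v → v < suc k → (count v u ≡ᵇ count v (baseMultiset (suc k) n)) ≡ (count v w ≡ᵇ count v (baseMultiset k n))
    sameTest v v<k = begin
      (count v u ≡ᵇ count v (baseMultiset (suc k) n))
        ≡⟨ sym (≡ᵇ-cancelʳ-+ (count v u) _ (𝟙 (v ≡ᵇ 0))) ⟩
      (count v u + 𝟙 (v ≡ᵇ 0) ≡ᵇ count v (baseMultiset (suc k) n) + 𝟙 (v ≡ᵇ 0))
        ≡⟨ cong₂ _≡ᵇ_ (eq v) (count-base-old k n v v<k k<n) ⟩
      (count v w + 𝟙 (v ≡ᵇ suc k) ≡ᵇ count v (baseMultiset k n))
        ≡⟨ cong (λ b → count v w + 𝟙 b ≡ᵇ count v (baseMultiset k n)) (<⇒≡ᵇ-false v<k) ⟩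
      (count v w + 0 ≡ᵇ count v (baseMultiset k n))
        ≡⟨ cong (_≡ᵇ count v (baseMultiset k n)) (ℕ.+-identityʳ (count v w)) ⟩
      (count v w ≡ᵇ count v (baseMultiset k n)) ∎

∑-𝔖-suc : ∀ k n → suc k ≤ n → ∀ (F : List ℕ → ℕ) → ∑ (𝔖 (suc k) n) F ≡ ∑ (𝔖 k n) (λ w → ∑ (fills (suc k) w) F)
∑-𝔖-suc k n k<n F = begin
  ∑ (𝔖 (suc k) n) F
    ≡⟨ ∑-filterᵇ (isPermOfBase (suc k) n) (words (range 0 (suc (suc k))) n) F ⟩
  ∑ (words (range 0 (suc (suc k))) n) (λ u → if isPermOfBase (suc k) n u then F u else 0)
    ≡⟨ cong (λ vs → ∑ (words vs n) (λ u → if isPermOfBase (suc k) n u then F u else 0)) (range-snoc 0 (suc k)) ⟩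
  ∑ (words (digits ++ [ suc k ]) n) (λ u → if isPermOfBase (suc k) n u then F u else 0)
    ≡⟨ ∑-cong (words (digits ++ [ suc k ]) n) newDigitOnce ⟩
  ∑ (words (digits ++ [ suc k ]) n) (λ u → if count (suc k) u ≡ᵇ 1 then F′ u else 0)
    ≡⟨ ∑-words-once digits (suc k) newDigit zeroOnce n F′ ⟩
  ∑ (words digits n) (λ w → ∑ (fills (suc k) w) F′)
    ≡⟨ ∑-cong (words digits n) fillsInherit ⟩
  ∑ (words digits n) (λ w → if isPermOfBase k n w then ∑ (fills (suc k) w) F else 0)
    ≡⟨ sym (∑-filterᵇ (isPermOfBase k n) (words digits n) (λ w → ∑ (fills (suc k) w) F)) ⟩
  ∑ (𝔖 k n) (λ w → ∑ (fills (suc k) w) F) ∎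
  where
  digits = range 0 (suc k)
  F′ : List ℕ → ℕ
  F′ u = if hasOldCounts k n u then F u else 0
  newDigit : All (λ v → (suc k ≡ᵇ v) ≡ false) digits
  newDigit = All.map (λ {v} (_ , v<) → >⇒≡ᵇ-false {suc k} {v} v<) (range-bounds 0 (suc k))
  zeroOnce : ∀ c → ∑ digits (λ v → if v ≡ᵇ 0 then c else 0) ≡ c
  zeroOnce c = trans (cong (c +_) (trans (∑-cong-All (range-bounds 1 k) (λ { (suc v) _ → refl })) (∑-zero (oneTo k))))
                     (ℕ.+-identityʳ c)
  newDigitOnce : ∀ u → (if isPermOfBase (suc k) n u then F u else 0) ≡ (if count (suc k) u ≡ᵇ 1 then F′ u else 0)
  newDigitOnce u = trans (cong (λ b → if b then F u else 0) (isPermOfBase-suc k n u)) (Bool.if-∧ (count (suc k) u ≡ᵇ 1))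
  fillsInherit : ∀ w → ∑ (fills (suc k) w) F′ ≡ (if isPermOfBase k n w then ∑ (fills (suc k) w) F else 0)
  fillsInherit w = trans
    (∑-cong-All (fills-ZeroReplaced (suc k) w) (λ u eq → cong (λ b → if b then F u else 0) (hasOldCounts-fill k n k<n w u eq)))
    (∑-if (fills (suc k) w) (isPermOfBase k n w) F)

𝔖-bounded : ∀ k n → All (λ w → length w ≡ n × All (_< suc k) w) (𝔖 k n)
𝔖-bounded k n =
  All.filter⁺ (T? ∘ isPermOfBase k n) (words-All (range 0 (suc k)) n (All.map proj₂ (range-bounds 0 (suc k))))

isPermOfBase-zeros : ∀ n → isPermOfBase 0 n (replicate n 0) ≡ true
isPermOfBase-zeros n = cong (_∧ true)
  (trans (cong (λ ys → count 0 (replicate n 0) ≡ᵇ count 0 ys) (List.++-identityʳ (replicate n 0)))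
         (≡ᵇ-refl (count 0 (replicate n 0))))

permSum : ℕ → ℕ → (Occupancy → ℕ) → ℕ
permSum n k h = ∑ (𝔖 k n) (λ π → weight π * h (support π))

permSum-suc : ∀ n k h → suc k ≤ n → Congruent _≗_ _≡_ h → permSum n (suc k) h ≡ permSum n k (carStep n h)
permSum-suc n k h k<n h-cong = trans (∑-𝔖-suc k n k<n _) (∑-cong-All (𝔖-bounded k n) fillsOf)
  where
  fillsOf : ∀ w → length w ≡ n × All (_< suc k) w →
    ∑ (fills (suc k) w) (λ u → weight u * h (support u)) ≡ weight w * carStep n h (support w)
  fillsOf w (len , w<k) = trans (∑-fills-weight k w h h-cong w<k) (cong (λ m → weight w * carStep m h (support w)) len)

parkingSum≡permSum-zero : ∀ n h → Congruent _≗_ _≡_ h → parkingSum n 0 h ≡ permSum n 0 h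
parkingSum≡permSum-zero n h h-cong = begin
  h (occupancy []) + 0
    ≡⟨ cong (_+ 0) (h-cong (λ i → cong (λ e → not (e ≡ᵇ 0)) (sym (entry-zeros n i)))) ⟩
  h (support zeros) + 0
    ≡⟨ cong (_+ 0) (sym (trans (cong (_* h (support zeros)) (weightGo-zeros [] n)) (ℕ.*-identityˡ _))) ⟩
  G zeros + 0
    ≡⟨ cong (λ b → (if b then G zeros else 0) + 0) (sym (isPermOfBase-zeros n)) ⟩
  ∑ [ zeros ] (λ π → if isPermOfBase 0 n π then G π else 0)
    ≡⟨ cong (λ ws → ∑ ws (λ π → if isPermOfBase 0 n π then G π else 0)) (sym (words-singleton 0 n)) ⟩
  ∑ (words (range 0 1) n) (λ π → if isPermOfBase 0 n π then G π else 0)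
    ≡⟨ sym (∑-filterᵇ (isPermOfBase 0 n) (words (range 0 1) n) G) ⟩
  permSum n 0 h ∎
  where
  zeros = replicate n 0
  G : List ℕ → ℕ
  G π = weight π * h (support π)

parkingSum≡permSum : ∀ n k → k ≤ n → ∀ h → Congruent _≗_ _≡_ h → parkingSum n k h ≡ permSum n k h
parkingSum≡permSum n zero _ h h-cong = parkingSum≡permSum-zero n h h-cong
parkingSum≡permSum n (suc k) k<n h h-cong = begin
  parkingSum n (suc k) h
    ≡⟨ parkingSum-suc n k h ⟩
  parkingSum n k (carStep n h)
    ≡⟨ parkingSum≡permSum n k (ℕ.<⇒≤ k<n) (carStep n h) (carStep-cong n h h-cong) ⟩
  permSum n k (carStep n h)
    ≡⟨ sym (permSum-suc n k h k<n h-cong) ⟩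
  permSum n (suc k) h ∎

-- The identity also holds for m = 0 (both sides are 1).
corollary2p17 : (m n : ℕ) → 1 ≤ m → m ≤ n →
    length (VPF m n) ≡ sum (map weight (𝔖 m n))
corollary2p17 m n _ m≤n = begin
  length (filterᵇ (isVPF n) (words (oneTo n) m))
    ≡⟨ length-filterᵇ (isVPF n) (words (oneTo n) m) ⟩
  ∑ (words (oneTo n) m) (λ α → if isVPF n α then 1 else 0)
    ≡⟨ ∑-cong (words (oneTo n) m) (λ α → parks (parkAll n [] α)) ⟩
  parkingSum n m (λ _ → 1)
    ≡⟨ parkingSum≡permSum n m m≤n (λ _ → 1) (λ _ → refl) ⟩
  ∑ (𝔖 m n) (λ π → weight π * 1)
    ≡⟨ ∑-cong (𝔖 m n) (λ π → ℕ.*-identityʳ (weight π)) ⟩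
  sum (map weight (𝔖 m n)) ∎
  where
  parks : ∀ r → (if is-just r then 1 else 0) ≡ maybe′ (λ _ → 1) 0 r
  parks nothing = refl
  parks (just _) = refl
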